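{- For each integer $n\ge 0$ let $M_{n,0}$ be the (unique) finite multiset of integers with $\tilde h(M_{n,0})=\tilde e(n,0,0)$. Then for every $n\ge 0$ there exists a finite multiset $M_{n,1}\in R(2^{n+1}-1)$ with $\tilde e(n,0,1)=\tilde h(M_{n,1})$, and $$\tilde e(n+1,0,1)=L(\tilde h(M_{n,0}))\,\tilde h\big(M_{n,0}+S_{ -1}(M_{n,0})\big)+2L(\tilde h(M_{n,0}))\,\tilde h(M_{n,0}+M_{n,1})+L(\tilde h(M_{n,1}))\,\tilde h(M_{n,0}+M_{n,0}),$$ where $L(\cdot)\,\tilde h(\cdot)$ denotes the left action of $\mathrm{CH}_2$.
   Context: Let $\mathrm{CH}_2$ be the commutative ring which is a free $\mathbb{Z}$-module with basis $\{h_i : i\ge 0\}$ and multiplication $h_ih_j=\sum_{k=0}^{\min(i,j)}h_{i+j-2k}$. Let $\tilde{\mathrm{CH}}_2$ be the free $\mathbb{Z}$-module with basis $\{\tilde h_i : i\in\mathbb{Z}\}$, with left $\mathrm{CH}_2$-action $h_i\tilde h_j=\sum_{k=0}^{i}\tilde h_{j-i+2k}$ ($i\ge0$), extended bilinearly. Let $L:\tilde{\mathrm{CH}}_2\to \mathrm{CH}_2$ be the $\mathbb{Z}$-linear map with $L(\tilde h_{ -1})=0$, $L(\tilde h_i)=h_i$ for $i\ge 0$, $L(\tilde h_i)=-h_{ -i-2}$ for $i\le -2$. The (associative, non-commutative) product on $\tilde{\mathrm{CH}}_2$ is $g_1g_2:=L(g_1)\,g_2$; powers $g^2=gg$. For $i\in\mathbb{Z}$,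 $S_i$ is the $\mathbb{Z}$-linear map with $S_i(\tilde h_j)=\tilde h_{j+i}$. Define $W_0(g_1,g_2,g_3)=g_2\big(g_1g_3-S_{ -1}(g_1)S_{ -1}(g_3)\big)$. Multisets: finite multisets of integers; $\mathrm{mult}(i,M)$ is the multiplicity of $i$; $\tilde h(M)=\sum_i\mathrm{mult}(i,M)\tilde h_i$; $M_1+M_2$ is the multiset $\{i_1+i_2:i_1\in M_1,i_2\in M_2\}$ with multiplicity, i.e. $\mathrm{mult}(i,M_1+M_2)=\sum_k\mathrm{mult}(i-k,M_1)\mathrm{mult}(k,M_2)$; $S_{i}(M)=M+\{i\}$; $\cup$ is multiset union. For integers $a\le b$, $a\equiv b\pmod 2$, $[a,b]=\{a,a+2,\dots,b\}$. For an integer $c$, $R(c)$ is the set of multisets of the form $\bigcup_{i=1}^{k_1}\{m_i\}\cup\bigcup_{i=1}^{k_2}[c-n_i,c+n_i]$ with integers $k_1,k_2\ge0$, $m_i\ge c$, $n_i\ge1$. Define $E_n:=\tilde e(n,0,0)$ by $E_0=\tilde h_2$ and $E_{n+1}=E_n\big(E_n^2-(S_{ -1}E_n)^2\big)$. Define $F_n:=\tilde e(n,0,1)$ by $F_0=0$ and $F_{n+1}=W_0(E_n,E_n,F_n+S_{ -1}E_n)+W_0(E_n,F_n,E_n)+W_0(F_n,E_n,E_n)$. -}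

module Defs where

open import Data.Nat as ℕ using (ℕ; zero; suc)
open import Data.Integer as ℤ using (ℤ; +_; -[1+_]; _+_; _-_; _*_; -_; _≤_)
open import Data.Product using (_×_; _,_; Σ-syntax)
open import Data.List using (List; []; _∷_; _++_; map; concatMap; upTo; sum)
open import Data.List.Relation.Unary.All using (All)
open import Relation.Nullary using (yes; no)
open import Relation.Binary.PropositionalEquality using (_≡_)

-- Elements of CH̃₂: finite formal ℤ-combinations of the basis h̃_i (i ∈ ℤ),
-- represented by lists of (index , coefficient); two representations denote
-- the same element iff all coefficients agree (see _≈_).

Elt : Set
Elt = List (ℤ × ℤ)

coeff : Elt → ℤ → ℤ
coeff [] i = + 0
coeff ((j , c) ∷ xs) i with j ℤ.≟ i
... | yes _ = c + coeff xs i
... | no  _ = coeff xs i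

infix 4 _≈_
_≈_ : Elt → Elt → Set
x ≈ y = ∀ i → coeff x i ≡ coeff y i

ht : ℤ → Elt
ht i = (i , + 1) ∷ []

infixl 6 _⊞_ _⊟_
_⊞_ : Elt → Elt → Elt
x ⊞ y = x ++ y

scale : ℤ → Elt → Elt
scale a = map (λ { (j , c) → (j , a * c) })

_⊟_ : Elt → Elt → Elt
x ⊟ y = x ++ scale (- + 1) y

S : ℤ → Elt → Elt
S i = map (λ { (j , c) → (j + i , c) })

-- Elements of CH₂: formal ℤ-combinations of h_i (i ∈ ℕ), as lists of
-- (index , coefficient).

CH : Set
CH = List (ℕ × ℤ)

L : Elt → CH
L [] = []
L ((+ n , c) ∷ xs) = (n , c) ∷ L xs
L ((-[1+ zero ] , c) ∷ xs) = L xs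
L ((-[1+ suc k ] , c) ∷ xs) = (k , - c) ∷ L xs   -- index -(k+2) ↦ h_k

actBasis : ℕ → ℤ → Elt
actBasis i j = map (λ k → (j - + i + + (2 ℕ.* k) , + 1)) (upTo (suc i))

act : CH → Elt → Elt
act a g = concatMap (λ { (i , c) → concatMap (λ { (j , d) → scale (c * d) (actBasis i j) }) g }) a

infixl 7 _·_
_·_ : Elt → Elt → Elt
g₁ · g₂ = act (L g₁) g₂

sq : Elt → Elt
sq g = g · g

W0 : Elt → Elt → Elt → Elt
W0 g₁ g₂ g₃ = g₂ · (g₁ · g₃ ⊟ S (- + 1) g₁ · S (- + 1) g₃)

E : ℕ → Elt
E zero = ht (+ 2)
E (suc n) = E n · (sq (E n) ⊟ sq (S (- + 1) (E n)))

F : ℕ → Elt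
F zero = []
F (suc n) = W0 (E n) (E n) (F n ⊞ S (- + 1) (E n)) ⊞ W0 (E n) (F n) (E n) ⊞ W0 (F n) (E n) (E n)

-- Finite multisets of integers, represented by lists (order irrelevant:
-- all notions below depend only on multiplicities).

Multiset : Set
Multiset = List ℤ

mult : ℤ → Multiset → ℕ
mult i [] = 0
mult i (j ∷ M) with j ℤ.≟ i
... | yes _ = suc (mult i M)
... | no  _ = mult i M

infix 4 _≋_
_≋_ : Multiset → Multiset → Set
M ≋ N = ∀ i → mult i M ≡ mult i N

hM : Multiset → Elt
hM = map (λ i → (i , + 1))

infixl 6 _⊕_
_⊕_ : Multiset → Multiset → Multiset
M₁ ⊕ M₂ = concatMap (λ a → map (λ b → a + b) M₂) M₁

SM : ℤ → Multiset → Multiset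
SM i M = M ⊕ (i ∷ [])

interval : ℤ → ℕ → Multiset
interval c n = map (λ k → c - + n + + (2 ℕ.* k)) (upTo (suc n))

R : ℤ → Multiset → Set
R c M = Σ[ ms ∈ List ℤ ] Σ[ ns ∈ List ℕ ]
          All (λ m → c ≤ m) ms × All (λ n → 1 ℕ.≤ n) ns ×
          (M ≋ ms ++ concatMap (interval c) ns)

-- CH̃₂ is the Laurent polynomial ring ℤ[x, x⁻¹] with h̃_j = x ^ j, and h_i acts by multiplication
-- with the SU(2) character χ_i = x ^ -i + x ^ (-i + 2) + ⋯ + x ^ i.  Hence g₁ g₂ = Lχ(g₁) g₂, where
-- Lχ is the linear map x ^ j ↦ χ_j (with χ_(-1) = 0 and χ_(-j-2) = -χ_j).  The recursion
-- χ_j = x⁻¹ χ_(j-1) + x ^ j gives g₁ g₃ - S₋₁(g₁) S₋₁(g₃) = g₁ ⋆ g₃ (the Laurent product), so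
-- W₀(g₁, g₂, g₃) = Lχ(g₂) g₁ g₃, E_(n+1) = Lχ(E_n) E_n² and
-- F_(n+1) = Lχ(E_n) E_n x⁻¹E_n + 2 Lχ(E_n) E_n F_n + Lχ(F_n) E_n²; with h̃(M + N) = h̃(M) h̃(N)
-- this is the displayed formula.
-- By induction E_n = x ^ (2 ^ (n+1)) P with P a sum of characters χ_k (k ≥ 0), and
-- F_n = x ^ (2 ^ (n+1) - 1) Q with Q a sum of monomials x ^ a (a ≥ 0) and such characters.  These
-- classes are stable under the products that occur, by the Pieri rule
-- χ_e χ_(k+1) = χ_(e-1) χ_k + χ_(e+k+1) and by Lχ(x ^ e χ_k) = χ_e χ_k.  Finally x ^ c Q = h̃(M)
-- for some M ∈ R(c): monomials give the points m_i ≥ c and characters χ_n the intervals [c-n, c+n].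

module Submission where

open import Defs
open import Data.Nat as ℕ using (ℕ; zero; suc; _^_)
open import Data.Integer as ℤ using (ℤ; +_; -[1+_]; _+_; _-_; _*_; -_; 0ℤ; 1ℤ; -1ℤ)
import Data.Integer.Properties as ℤP
import Data.Nat.Properties as ℕP
open import Data.Integer.Tactic.RingSolver using (solve-∀)
open import Data.List using (List; []; _∷_; _++_; map; concatMap; length; upTo; applyUpTo)
import Data.List.Properties as List
open import Data.List.Relation.Unary.All using (All; []; _∷_)
import Data.List.Relation.Unary.All as All
import Data.List.Relation.Unary.All.Properties as All
open import Data.Product using (_×_; _,_; Σ-syntax)
open import Function using (_∘_)
open import Relation.Binary.Bundles using (Setoid)
open import Relation.Binary.Structures using (IsEquivalence)
open import Relation.Binary.PropositionalEquality
open import Relation.Nullary using (yes; no; ¬_; contradiction)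
import Relation.Binary.Reasoning.Setoid
open import Algebra.Bundles using (CommutativeMonoid)
open import Algebra.Structures using (IsCommutativeMonoid)
import Algebra.Properties.CommutativeSemigroup as CommutativeSemigroupProperties
open import Algebra.Morphism.Structures using (module MonoidMorphisms)
import Algebra.Solver.CommutativeMonoid as CommutativeMonoidSolver

-- Representations of elements of CH̃₂ are compared through the functionals T ↦ Σ c · T j
-- they induce on test functions T : ℤ → ℤ; this agrees with _≈_ (≃⇒≈, ≈⇒≃) and turns
-- every identity into an identity in ℤ.

⟪_⟫ : Elt → (ℤ → ℤ) → ℤ
⟪ [] ⟫ T = 0ℤ
⟪ (j , c) ∷ g ⟫ T = c * T j + ⟪ g ⟫ T

infix 4 _≃_
record _≃_ (g h : Elt) : Set where
  constructor mk≃
  field at : ∀ T → ⟪ g ⟫ T ≡ ⟪ h ⟫ T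
open _≃_ public

≃-isEquivalence : IsEquivalence _≃_
≃-isEquivalence = record
  { refl  = mk≃ λ _ → refl
  ; sym   = λ p → mk≃ λ T → sym (at p T)
  ; trans = λ p q → mk≃ λ T → trans (at p T) (at q T)
  }

≃-setoid : Setoid _ _
≃-setoid = record { isEquivalence = ≃-isEquivalence }

open Setoid ≃-setoid public
  using () renaming (refl to ≃-refl; sym to ≃-sym; trans to ≃-trans; reflexive to ≃-reflexive)

module ≃-Reasoning = Relation.Binary.Reasoning.Setoid ≃-setoid

variable
  g h g′ h′ : Elt

⟪⟫-++ : ∀ g h T → ⟪ g ++ h ⟫ T ≡ ⟪ g ⟫ T + ⟪ h ⟫ T
⟪⟫-++ [] h T = sym (ℤP.+-identityˡ _)
⟪⟫-++ ((j , c) ∷ g) h T = trans (cong (_+_ (c * T j)) (⟪⟫-++ g h T)) (sym (ℤP.+-assoc (c * T j) (⟪ g ⟫ T) (⟪ h ⟫ T)))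

⟪⟫-scale : ∀ a g T → ⟪ scale a g ⟫ T ≡ a * ⟪ g ⟫ T
⟪⟫-scale a [] T = sym (ℤP.*-zeroʳ a)
⟪⟫-scale a ((j , c) ∷ g) T = begin
  a * c * T j + ⟪ scale a g ⟫ T   ≡⟨ cong₂ _+_ (ℤP.*-assoc a c (T j)) (⟪⟫-scale a g T) ⟩
  a * (c * T j) + a * ⟪ g ⟫ T     ≡⟨ ℤP.*-distribˡ-+ a _ _ ⟨
  a * (c * T j + ⟪ g ⟫ T)         ∎
  where open ≡-Reasoning

⟪⟫-⊟ : ∀ g h T → ⟪ g ⊟ h ⟫ T ≡ ⟪ g ⟫ T - ⟪ h ⟫ T
⟪⟫-⊟ g h T = trans (⟪⟫-++ g _ T) (cong (_+_ (⟪ g ⟫ T)) (trans (⟪⟫-scale -1ℤ h T) (ℤP.-1*i≡-i _)))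

⟪⟫-S : ∀ k g T → ⟪ S k g ⟫ T ≡ ⟪ g ⟫ (λ j → T (j + k))
⟪⟫-S k [] T = refl
⟪⟫-S k ((j , c) ∷ g) T = cong (_+_ (c * T (j + k))) (⟪⟫-S k g T)

⟪⟫-ht : ∀ j T → ⟪ ht j ⟫ T ≡ T j
⟪⟫-ht j T = trans (ℤP.+-identityʳ _) (ℤP.*-identityˡ _)

⟪⟫-cong : ∀ g {T U : ℤ → ℤ} → (∀ j → T j ≡ U j) → ⟪ g ⟫ T ≡ ⟪ g ⟫ U
⟪⟫-cong [] e = refl
⟪⟫-cong ((j , c) ∷ g) e = cong₂ _+_ (cong (c *_) (e j)) (⟪⟫-cong g e)

⟪⟫-+ : ∀ g T U → ⟪ g ⟫ (λ j → T j + U j) ≡ ⟪ g ⟫ T + ⟪ g ⟫ U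
⟪⟫-+ [] T U = refl
⟪⟫-+ ((j , c) ∷ g) T U =
  trans (cong (_+_ (c * (T j + U j))) (⟪⟫-+ g T U)) (lemma c (T j) (U j) (⟪ g ⟫ T) (⟪ g ⟫ U))
  where
  lemma : ∀ c t u a b → c * (t + u) + (a + b) ≡ c * t + a + (c * u + b)
  lemma = solve-∀

⟪⟫-* : ∀ g a T → ⟪ g ⟫ (λ j → a * T j) ≡ a * ⟪ g ⟫ T
⟪⟫-* [] a T = sym (ℤP.*-zeroʳ a)
⟪⟫-* ((j , c) ∷ g) a T =
  trans (cong (_+_ (c * (a * T j))) (⟪⟫-* g a T)) (lemma c a (T j) (⟪ g ⟫ T))
  where
  lemma : ∀ c a t l → c * (a * t) + a * l ≡ a * (c * t + l)
  lemma = solve-∀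

⟪⟫-0 : ∀ g → ⟪ g ⟫ (λ _ → 0ℤ) ≡ 0ℤ
⟪⟫-0 g = ⟪⟫-* g 0ℤ (λ _ → 0ℤ)

⟪⟫-swap : ∀ g h (T : ℤ → ℤ → ℤ) →
          ⟪ g ⟫ (λ j → ⟪ h ⟫ (λ k → T j k)) ≡ ⟪ h ⟫ (λ k → ⟪ g ⟫ (λ j → T j k))
⟪⟫-swap [] h T = sym (⟪⟫-0 h)
⟪⟫-swap ((j , c) ∷ g) h T = begin
  c * ⟪ h ⟫ (T j) + ⟪ g ⟫ (λ j → ⟪ h ⟫ (T j))               ≡⟨ cong₂ _+_ (sym (⟪⟫-* h c (T j))) (⟪⟫-swap g h T) ⟩
  ⟪ h ⟫ (λ k → c * T j k) + ⟪ h ⟫ (λ k → ⟪ g ⟫ (λ j → T j k)) ≡⟨ ⟪⟫-+ h _ _ ⟨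
  ⟪ h ⟫ (λ k → c * T j k + ⟪ g ⟫ (λ j → T j k))               ∎
  where open ≡-Reasoning

coeff-⟪⟫ : ∀ g i → coeff g i ≡ ⟪ g ⟫ (λ j → coeff (ht j) i)
coeff-⟪⟫ [] i = refl
coeff-⟪⟫ ((j , c) ∷ g) i with j ℤ.≟ i
... | yes _ = cong₂ _+_ (sym (ℤP.*-identityʳ c)) (coeff-⟪⟫ g i)
... | no  _ = trans (coeff-⟪⟫ g i) (sym (trans (cong (_+ _) (ℤP.*-zeroʳ c)) (ℤP.+-identityˡ _)))

≃⇒≈ : g ≃ h → g ≈ h
≃⇒≈ {g} {h} p i = trans (coeff-⟪⟫ g i) (trans (at p _) (sym (coeff-⟪⟫ h i)))

remove : ℤ → Elt → Elt
remove i [] = []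
remove i ((j , c) ∷ g) with j ℤ.≟ i
... | yes _ = remove i g
... | no  _ = (j , c) ∷ remove i g

⟪⟫-remove : ∀ i g T → ⟪ g ⟫ T ≡ coeff g i * T i + ⟪ remove i g ⟫ T
⟪⟫-remove i [] T = refl
⟪⟫-remove i ((j , c) ∷ g) T with j ℤ.≟ i
... | yes refl =
  trans (cong (_+_ (c * T j)) (⟪⟫-remove j g T)) (lemma c (coeff g j) (T j) (⟪ remove j g ⟫ T))
  where
  lemma : ∀ c d t r → c * t + (d * t + r) ≡ (c + d) * t + r
  lemma = solve-∀
... | no _ =
  trans (cong (_+_ (c * T j)) (⟪⟫-remove i g T)) (lemma c (coeff g i) (T i) (T j) (⟪ remove i g ⟫ T))
  where
  lemma : ∀ c d t u r → c * u + (d * t + r) ≡ d * t + (c * u + r)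
  lemma = solve-∀

coeff-remove-≢ : ∀ i g j → ¬ j ≡ i → coeff (remove i g) j ≡ coeff g j
coeff-remove-≢ i [] j j≢i = refl
coeff-remove-≢ i ((k , c) ∷ g) j j≢i with k ℤ.≟ i
coeff-remove-≢ i ((k , c) ∷ g) j j≢i | yes refl with k ℤ.≟ j
... | yes refl = contradiction refl j≢i
... | no _     = coeff-remove-≢ i g j j≢i
coeff-remove-≢ i ((k , c) ∷ g) j j≢i | no _ with k ℤ.≟ j
... | yes _ = cong (_+_ c) (coeff-remove-≢ i g j j≢i)
... | no _  = coeff-remove-≢ i g j j≢i

coeff-remove-≡ : ∀ i g → coeff (remove i g) i ≡ 0ℤ
coeff-remove-≡ i [] = refl
coeff-remove-≡ i ((k , c) ∷ g) with k ℤ.≟ i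
... | yes _ = coeff-remove-≡ i g
... | no k≢i with k ℤ.≟ i
...   | yes k≡i = contradiction k≡i k≢i
...   | no _    = coeff-remove-≡ i g

length-remove : ∀ i g → length (remove i g) ℕ.≤ length g
length-remove i [] = ℕ.z≤n
length-remove i ((k , c) ∷ g) with k ℤ.≟ i
... | yes _ = ℕP.m≤n⇒m≤1+n (length-remove i g)
... | no  _ = ℕ.s≤s (length-remove i g)

-- Induction on a bound for the length, since removing an index is not structural.
⟪⟫-vanishing : ∀ n g {T} → length g ℕ.≤ n → (∀ i → coeff g i ≡ 0ℤ) → ⟪ g ⟫ T ≡ 0ℤ
⟪⟫-vanishing n [] _ _ = refl
⟪⟫-vanishing (suc n) g@((k , c) ∷ g′) {T} (ℕ.s≤s |g′|≤n) g≗0 = begin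
  ⟪ g ⟫ T                                ≡⟨ ⟪⟫-remove k g T ⟩
  coeff g k * T k + ⟪ remove k g ⟫ T    ≡⟨ cong₂ _+_ (cong (_* T k) (g≗0 k)) (⟪⟫-vanishing n (remove k g) |remove|≤n removed≗0) ⟩
  0ℤ                                     ∎
  where
  open ≡-Reasoning
  |remove|≤n : length (remove k g) ℕ.≤ n
  |remove|≤n with k ℤ.≟ k
  ... | yes _   = ℕP.≤-trans (length-remove k g′) |g′|≤n
  ... | no k≢k  = contradiction refl k≢k
  removed≗0 : ∀ i → coeff (remove k g) i ≡ 0ℤ
  removed≗0 i with i ℤ.≟ k
  ... | yes refl = coeff-remove-≡ i g
  ... | no i≢k   = trans (coeff-remove-≢ k g i i≢k) (g≗0 i)

≈⇒≃ : g ≈ h → g ≃ h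
≈⇒≃ {g} {h} g≈h = mk≃ λ T → begin
  ⟪ g ⟫ T                           ≡⟨ lemma (⟪ g ⟫ T) (⟪ h ⟫ T) ⟩
  (⟪ g ⟫ T - ⟪ h ⟫ T) + ⟪ h ⟫ T     ≡⟨ cong (_+ ⟪ h ⟫ T) (sym (⟪⟫-⊟ g h T)) ⟩
  ⟪ g ⊟ h ⟫ T + ⟪ h ⟫ T             ≡⟨ cong (_+ ⟪ h ⟫ T) (⟪⟫-vanishing _ (g ⊟ h) ℕP.≤-refl difference≗0) ⟩
  0ℤ + ⟪ h ⟫ T                      ≡⟨ ℤP.+-identityˡ _ ⟩
  ⟪ h ⟫ T                           ∎
  where
  open ≡-Reasoning
  lemma : ∀ a b → a ≡ (a - b) + b
  lemma = solve-∀
  difference≗0 : ∀ i → coeff (g ⊟ h) i ≡ 0ℤ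
  difference≗0 i = begin
    coeff (g ⊟ h) i                          ≡⟨ coeff-⟪⟫ (g ⊟ h) i ⟩
    ⟪ g ⊟ h ⟫ (λ j → coeff (ht j) i)         ≡⟨ ⟪⟫-⊟ g h _ ⟩
    ⟪ g ⟫ (λ j → coeff (ht j) i) - ⟪ h ⟫ (λ j → coeff (ht j) i) ≡⟨ cong₂ _-_ (coeff-⟪⟫ g i) (coeff-⟪⟫ h i) ⟨
    coeff g i - coeff h i                    ≡⟨ cong (_- coeff h i) (g≈h i) ⟩
    coeff h i - coeff h i                    ≡⟨ ℤP.+-inverseʳ (coeff h i) ⟩
    0ℤ                                       ∎

-- CH̃₂ as the Laurent polynomial ring ℤ[x, x⁻¹] (h̃ j ↦ x ^ j)

infixl 7 _⋆_
_⋆_ : Elt → Elt → Elt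
g ⋆ h = concatMap (λ (j , c) → scale c (S j h)) g

⟪⟫-⋆ : ∀ g h T → ⟪ g ⋆ h ⟫ T ≡ ⟪ g ⟫ (λ j → ⟪ h ⟫ (λ k → T (k + j)))
⟪⟫-⋆ [] h T = refl
⟪⟫-⋆ ((j , c) ∷ g) h T = trans (⟪⟫-++ (scale c (S j h)) (g ⋆ h) T)
  (cong₂ _+_ (trans (⟪⟫-scale c (S j h) T) (cong (c *_) (⟪⟫-S j h T))) (⟪⟫-⋆ g h T))

⊞-cong : g ≃ g′ → h ≃ h′ → g ⊞ h ≃ g′ ⊞ h′
⊞-cong {g} {g′} {h} {h′} p q = mk≃ λ T →
  trans (⟪⟫-++ g h T) (trans (cong₂ _+_ (at p T) (at q T)) (sym (⟪⟫-++ g′ h′ T)))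

scale-cong : ∀ a → g ≃ h → scale a g ≃ scale a h
scale-cong {g} {h} a p = mk≃ λ T →
  trans (⟪⟫-scale a g T) (trans (cong (a *_) (at p T)) (sym (⟪⟫-scale a h T)))

S-cong : ∀ k → g ≃ h → S k g ≃ S k h
S-cong {g} {h} k p = mk≃ λ T → trans (⟪⟫-S k g T) (trans (at p _) (sym (⟪⟫-S k h T)))

⋆-cong : g ≃ g′ → h ≃ h′ → g ⋆ h ≃ g′ ⋆ h′
⋆-cong {g} {g′} {h} {h′} p q = mk≃ λ T → begin
  ⟪ g ⋆ h ⟫ T                                  ≡⟨ ⟪⟫-⋆ g h T ⟩
  ⟪ g ⟫ (λ j → ⟪ h ⟫ (λ k → T (k + j)))        ≡⟨ at p _ ⟩
  ⟪ g′ ⟫ (λ j → ⟪ h ⟫ (λ k → T (k + j)))       ≡⟨ ⟪⟫-cong g′ (λ j → at q _) ⟩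
  ⟪ g′ ⟫ (λ j → ⟪ h′ ⟫ (λ k → T (k + j)))      ≡⟨ ⟪⟫-⋆ g′ h′ T ⟨
  ⟪ g′ ⋆ h′ ⟫ T                                ∎
  where open ≡-Reasoning

⊞-congˡ : ∀ g → h ≃ h′ → g ⊞ h ≃ g ⊞ h′
⊞-congˡ g = ⊞-cong (≃-refl {g})

⊞-congʳ : ∀ h → g ≃ g′ → g ⊞ h ≃ g′ ⊞ h
⊞-congʳ h p = ⊞-cong p (≃-refl {h})

⊞-comm : ∀ g h → g ⊞ h ≃ h ⊞ g
⊞-comm g h = mk≃ λ T →
  trans (⟪⟫-++ g h T) (trans (ℤP.+-comm (⟪ g ⟫ T) (⟪ h ⟫ T)) (sym (⟪⟫-++ h g T)))

⊞-assoc : ∀ g h k → g ⊞ h ⊞ k ≃ g ⊞ (h ⊞ k)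
⊞-assoc g h k = ≃-reflexive (List.++-assoc g h k)

⊞-identityʳ : ∀ g → g ⊞ [] ≃ g
⊞-identityʳ g = ≃-reflexive (List.++-identityʳ g)

⊞-isCommutativeMonoid : IsCommutativeMonoid _≃_ _⊞_ []
⊞-isCommutativeMonoid = record
  { isMonoid = record
    { isSemigroup = record
      { isMagma = record { isEquivalence = ≃-isEquivalence ; ∙-cong = ⊞-cong }
      ; assoc   = ⊞-assoc
      }
    ; identity = (λ _ → ≃-refl) , ⊞-identityʳ
    }
  ; comm = ⊞-comm
  }

⊞-commutativeMonoid : CommutativeMonoid _ _
⊞-commutativeMonoid = record { isCommutativeMonoid = ⊞-isCommutativeMonoid }

open CommutativeSemigroupProperties (CommutativeMonoid.commutativeSemigroup ⊞-commutativeMonoid)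
  using () renaming (interchange to ⊞-interchange; x∙yz≈y∙xz to x⊞yz≃y⊞xz)
open CommutativeMonoidSolver ⊞-commutativeMonoid using (solve; _⊜_) renaming (_⊕_ to _∙_)

scale-two : ∀ g → scale (+ 2) g ≃ g ⊞ g
scale-two g = mk≃ λ T → trans (⟪⟫-scale (+ 2) g T) (trans (lemma (⟪ g ⟫ T)) (sym (⟪⟫-++ g g T)))
  where
  lemma : ∀ a → + 2 * a ≡ a + a
  lemma = solve-∀

S-⊞ : ∀ k g h → S k (g ⊞ h) ≃ S k g ⊞ S k h
S-⊞ k g h = ≃-reflexive (List.map-++ _ g h)

S-S : ∀ a b g → S a (S b g) ≃ S (b + a) g
S-S a b g = mk≃ λ T → begin
  ⟪ S a (S b g) ⟫ T                ≡⟨ trans (⟪⟫-S a (S b g) T) (⟪⟫-S b g _) ⟩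
  ⟪ g ⟫ (λ j → T (j + b + a))      ≡⟨ ⟪⟫-cong g (λ j → cong T (ℤP.+-assoc j b a)) ⟩
  ⟪ g ⟫ (λ j → T (j + (b + a)))    ≡⟨ ⟪⟫-S (b + a) g T ⟨
  ⟪ S (b + a) g ⟫ T                ∎
  where open ≡-Reasoning

S-zero : ∀ g → S 0ℤ g ≃ g
S-zero g = mk≃ λ T → trans (⟪⟫-S 0ℤ g T) (⟪⟫-cong g (λ j → cong T (ℤP.+-identityʳ j)))

⋆-comm : ∀ g h → g ⋆ h ≃ h ⋆ g
⋆-comm g h = mk≃ λ T → begin
  ⟪ g ⋆ h ⟫ T                               ≡⟨ ⟪⟫-⋆ g h T ⟩
  ⟪ g ⟫ (λ j → ⟪ h ⟫ (λ k → T (k + j)))     ≡⟨ ⟪⟫-swap g h _ ⟩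
  ⟪ h ⟫ (λ k → ⟪ g ⟫ (λ j → T (k + j)))     ≡⟨ ⟪⟫-cong h (λ k → ⟪⟫-cong g (λ j → cong T (ℤP.+-comm k j))) ⟩
  ⟪ h ⟫ (λ k → ⟪ g ⟫ (λ j → T (j + k)))     ≡⟨ ⟪⟫-⋆ h g T ⟨
  ⟪ h ⋆ g ⟫ T                               ∎
  where open ≡-Reasoning

⋆-distribˡ : ∀ g h k → (g ⊞ h) ⋆ k ≃ g ⋆ k ⊞ h ⋆ k
⋆-distribˡ g h k = ≃-reflexive (List.concatMap-++ _ g h)

⋆-distribʳ : ∀ g h k → g ⋆ (h ⊞ k) ≃ g ⋆ h ⊞ g ⋆ k
⋆-distribʳ g h k = mk≃ λ T → begin
  ⟪ g ⋆ (h ⊞ k) ⟫ T                                                        ≡⟨ ⟪⟫-⋆ g (h ⊞ k) T ⟩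
  ⟪ g ⟫ (λ j → ⟪ h ⊞ k ⟫ (λ i → T (i + j)))                                ≡⟨ ⟪⟫-cong g (λ j → ⟪⟫-++ h k _) ⟩
  ⟪ g ⟫ (λ j → ⟪ h ⟫ (λ i → T (i + j)) + ⟪ k ⟫ (λ i → T (i + j)))          ≡⟨ ⟪⟫-+ g _ _ ⟩
  ⟪ g ⟫ (λ j → ⟪ h ⟫ (λ i → T (i + j))) + ⟪ g ⟫ (λ j → ⟪ k ⟫ (λ i → T (i + j))) ≡⟨ cong₂ _+_ (⟪⟫-⋆ g h T) (⟪⟫-⋆ g k T) ⟨
  ⟪ g ⋆ h ⟫ T + ⟪ g ⋆ k ⟫ T                                                ≡⟨ ⟪⟫-++ (g ⋆ h) (g ⋆ k) T ⟨
  ⟪ g ⋆ h ⊞ g ⋆ k ⟫ T                                                      ∎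
  where open ≡-Reasoning

⋆-zeroʳ : ∀ g → g ⋆ [] ≃ []
⋆-zeroʳ g = mk≃ λ T → trans (⟪⟫-⋆ g [] T) (⟪⟫-0 g)

⋆-ht : ∀ g k → g ⋆ ht k ≃ S k g
⋆-ht g k = mk≃ λ T → begin
  ⟪ g ⋆ ht k ⟫ T                                ≡⟨ ⟪⟫-⋆ g (ht k) T ⟩
  ⟪ g ⟫ (λ j → ⟪ ht k ⟫ (λ i → T (i + j)))      ≡⟨ ⟪⟫-cong g (λ j → trans (⟪⟫-ht k (λ i → T (i + j))) (cong T (ℤP.+-comm k j))) ⟩
  ⟪ g ⟫ (λ j → T (j + k))                       ≡⟨ ⟪⟫-S k g T ⟨
  ⟪ S k g ⟫ T                                   ∎
  where open ≡-Reasoning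

⋆-S : ∀ k g h → g ⋆ S k h ≃ S k (g ⋆ h)
⋆-S k g h = mk≃ λ T → begin
  ⟪ g ⋆ S k h ⟫ T                                   ≡⟨ ⟪⟫-⋆ g (S k h) T ⟩
  ⟪ g ⟫ (λ j → ⟪ S k h ⟫ (λ i → T (i + j)))         ≡⟨ ⟪⟫-cong g (λ j → trans (⟪⟫-S k h _) (⟪⟫-cong h (λ i → cong T (lemma i j k)))) ⟩
  ⟪ g ⟫ (λ j → ⟪ h ⟫ (λ i → T (i + j + k)))         ≡⟨ trans (⟪⟫-S k (g ⋆ h) T) (⟪⟫-⋆ g h _) ⟨
  ⟪ S k (g ⋆ h) ⟫ T                                 ∎
  where
  open ≡-Reasoning
  lemma : ∀ i j k → i + k + j ≡ i + j + k
  lemma = solve-∀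

S-⋆ : ∀ k g h → S k g ⋆ h ≃ S k (g ⋆ h)
S-⋆ k g h = ≃-trans (⋆-comm (S k g) h) (≃-trans (⋆-S k h g) (S-cong k (⋆-comm h g)))

S-⋆-S : ∀ a b g h → S a g ⋆ S b h ≃ S (a + b) (g ⋆ h)
S-⋆-S a b g h = begin
  S a g ⋆ S b h        ≈⟨ S-⋆ a g (S b h) ⟩
  S a (g ⋆ S b h)      ≈⟨ S-cong a (⋆-S b g h) ⟩
  S a (S b (g ⋆ h))    ≈⟨ S-S a b (g ⋆ h) ⟩
  S (b + a) (g ⋆ h)    ≈⟨ ≃-reflexive (cong (λ k → S k (g ⋆ h)) (ℤP.+-comm b a)) ⟩
  S (a + b) (g ⋆ h)    ∎
  where open ≃-Reasoning

⊟-cong : g ≃ g′ → h ≃ h′ → g ⊟ h ≃ g′ ⊟ h′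
⊟-cong p q = ⊞-cong p (scale-cong -1ℤ q)

⋆-⊟-distribˡ : ∀ g h k → (g ⊟ h) ⋆ k ≃ g ⋆ k ⊟ h ⋆ k
⋆-⊟-distribˡ g h k = mk≃ λ T → begin
  ⟪ (g ⊟ h) ⋆ k ⟫ T                                ≡⟨ ⟪⟫-⋆ (g ⊟ h) k T ⟩
  ⟪ g ⊟ h ⟫ (λ j → ⟪ k ⟫ (λ i → T (i + j)))        ≡⟨ ⟪⟫-⊟ g h _ ⟩
  ⟪ g ⟫ (λ j → ⟪ k ⟫ (λ i → T (i + j))) - ⟪ h ⟫ (λ j → ⟪ k ⟫ (λ i → T (i + j)))
                                                   ≡⟨ cong₂ _-_ (⟪⟫-⋆ g k T) (⟪⟫-⋆ h k T) ⟨
  ⟪ g ⋆ k ⟫ T - ⟪ h ⋆ k ⟫ T                        ≡⟨ ⟪⟫-⊟ (g ⋆ k) (h ⋆ k) T ⟨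
  ⟪ g ⋆ k ⊟ h ⋆ k ⟫ T                              ∎
  where open ≡-Reasoning

⊞-⊟-cancelˡ : ∀ g h → g ⊞ h ⊟ g ≃ h
⊞-⊟-cancelˡ g h = mk≃ λ T → begin
  ⟪ g ⊞ h ⊟ g ⟫ T                   ≡⟨ ⟪⟫-⊟ (g ⊞ h) g T ⟩
  ⟪ g ⊞ h ⟫ T - ⟪ g ⟫ T             ≡⟨ cong (_- ⟪ g ⟫ T) (⟪⟫-++ g h T) ⟩
  ⟪ g ⟫ T + ⟪ h ⟫ T - ⟪ g ⟫ T       ≡⟨ lemma (⟪ g ⟫ T) (⟪ h ⟫ T) ⟩
  ⟪ h ⟫ T                           ∎
  where
  open ≡-Reasoning
  lemma : ∀ a b → a + b - a ≡ b
  lemma = solve-∀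

-- Arithmetic progressions and characters

-- x ^ s + x ^ (s + 2) + ⋯ (n terms); actBasis i j is definitionally progression (j - i) (suc i).
progression : ℤ → ℕ → Elt
progression s n = map (λ k → (s + + (2 ℕ.* k) , 1ℤ)) (upTo n)

+[2*]≡ : ∀ k → + (2 ℕ.* k) ≡ + k + + k
+[2*]≡ k = cong (λ m → + (k ℕ.+ m)) (ℕP.+-identityʳ k)

progression-snoc : ∀ s n → progression s (suc n) ≃ progression s n ⊞ ht (s + + (2 ℕ.* n))
progression-snoc s n = ≃-reflexive (begin
  map f (upTo (suc n))          ≡⟨ cong (map f) (List.upTo-∷ʳ n) ⟨
  map f (upTo n ++ n ∷ [])      ≡⟨ List.map-++ f (upTo n) (n ∷ []) ⟩
  map f (upTo n) ++ f n ∷ []    ∎)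
  where
  open ≡-Reasoning
  f = λ k → (s + + (2 ℕ.* k) , 1ℤ)

progression-cons : ∀ s n → progression s (suc n) ≃ ht s ⊞ progression (s + + 2) n
progression-cons s n = ≃-reflexive (cong₂ _∷_ (cong (_, 1ℤ) (ℤP.+-identityʳ s)) (begin
  map f (applyUpTo suc n)        ≡⟨ List.map-applyUpTo suc f n ⟩
  applyUpTo (f ∘ suc) n          ≡⟨ List.map-applyUpTo (λ k → k) (f ∘ suc) n ⟨
  map (f ∘ suc) (upTo n)         ≡⟨ List.map-cong (λ k → cong (_, 1ℤ) (index k)) (upTo n) ⟩
  map f₂ (upTo n)                ∎))
  where
  open ≡-Reasoning
  f  = λ k → (s + + (2 ℕ.* k) , 1ℤ)
  f₂ = λ k → (s + + 2 + + (2 ℕ.* k) , 1ℤ)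
  lemma : ∀ s k → s + ((+ 1 + k) + (+ 1 + k)) ≡ s + + 2 + (k + k)
  lemma = solve-∀
  index : ∀ k → s + + (2 ℕ.* suc k) ≡ s + + 2 + + (2 ℕ.* k)
  index k rewrite +[2*]≡ k | +[2*]≡ (suc k) = lemma s (+ k)

S-progression : ∀ k s n → S k (progression s n) ≃ progression (s + k) n
S-progression k s n = ≃-reflexive (begin
  map shift (map f (upTo n))    ≡⟨ List.map-∘ (upTo n) ⟨
  map (shift ∘ f) (upTo n)      ≡⟨ List.map-cong (λ m → cong (_, 1ℤ) (lemma s k (+ (2 ℕ.* m)))) (upTo n) ⟩
  map f₂ (upTo n)               ∎)
  where
  open ≡-Reasoning
  f  = λ m → (s + + (2 ℕ.* m) , 1ℤ)
  f₂ = λ m → (s + k + + (2 ℕ.* m) , 1ℤ)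
  shift : ℤ × ℤ → ℤ × ℤ
  shift (j , c) = (j + k , c)
  lemma : ∀ s k m → s + m + k ≡ s + k + m
  lemma = solve-∀

-- h_i ↦ h_i h̃₀ = χ_i.
character : CH → Elt
character = concatMap (λ (i , c) → scale c (actBasis i 0ℤ))

Lχ : Elt → Elt
Lχ g = character (L g)

χ : ℤ → Elt
χ j = Lχ (ht j)

⟪⟫-character-∷ : ∀ i c a T → ⟪ character ((i , c) ∷ a) ⟫ T ≡ c * ⟪ actBasis i 0ℤ ⟫ T + ⟪ character a ⟫ T
⟪⟫-character-∷ i c a T = trans (⟪⟫-++ (scale c (actBasis i 0ℤ)) (character a) T)
                               (cong (_+ ⟪ character a ⟫ T) (⟪⟫-scale c (actBasis i 0ℤ) T))

⟪⟫-χ : ∀ k T → ⟪ χ (+ k) ⟫ T ≡ ⟪ actBasis k 0ℤ ⟫ T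
⟪⟫-χ k T = trans (⟪⟫-character-∷ k 1ℤ [] T) (trans (ℤP.+-identityʳ _) (ℤP.*-identityˡ _))

⟪⟫-χ-reflect : ∀ k T → ⟪ χ -[1+ suc k ] ⟫ T ≡ - ⟪ χ (+ k) ⟫ T
⟪⟫-χ-reflect k T = begin
  ⟪ χ -[1+ suc k ] ⟫ T              ≡⟨ trans (⟪⟫-character-∷ k -1ℤ [] T) (ℤP.+-identityʳ _) ⟩
  -1ℤ * ⟪ actBasis k 0ℤ ⟫ T         ≡⟨ ℤP.-1*i≡-i _ ⟩
  - ⟪ actBasis k 0ℤ ⟫ T             ≡⟨ cong -_ (⟪⟫-χ k T) ⟨
  - ⟪ χ (+ k) ⟫ T                   ∎
  where open ≡-Reasoning

χ≃progression : ∀ k → χ (+ k) ≃ progression (- + k) (suc k)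
χ≃progression k = mk≃ λ T →
  trans (⟪⟫-χ k T) (cong (λ s → ⟪ progression s (suc k) ⟫ T) (ℤP.+-identityˡ (- + k)))

⟪⟫-Lχ : ∀ g T → ⟪ Lχ g ⟫ T ≡ ⟪ g ⟫ (λ j → ⟪ χ j ⟫ T)
⟪⟫-Lχ [] T = refl
⟪⟫-Lχ ((+ n , c) ∷ g) T = begin
  ⟪ character ((n , c) ∷ L g) ⟫ T                          ≡⟨ ⟪⟫-character-∷ n c (L g) T ⟩
  c * ⟪ actBasis n 0ℤ ⟫ T + ⟪ Lχ g ⟫ T                     ≡⟨ cong₂ _+_ (cong (c *_) (sym (⟪⟫-χ n T))) (⟪⟫-Lχ g T) ⟩
  c * ⟪ χ (+ n) ⟫ T + ⟪ g ⟫ (λ j → ⟪ χ j ⟫ T)              ∎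
  where open ≡-Reasoning
⟪⟫-Lχ ((-[1+ zero ] , c) ∷ g) T =
  trans (⟪⟫-Lχ g T) (sym (trans (cong (_+ _) (ℤP.*-zeroʳ c)) (ℤP.+-identityˡ _)))
⟪⟫-Lχ ((-[1+ suc k ] , c) ∷ g) T = begin
  ⟪ character ((k , - c) ∷ L g) ⟫ T                        ≡⟨ ⟪⟫-character-∷ k (- c) (L g) T ⟩
  - c * ⟪ actBasis k 0ℤ ⟫ T + ⟪ Lχ g ⟫ T                   ≡⟨ cong₂ _+_ (lemma c _) (⟪⟫-Lχ g T) ⟩
  c * - ⟪ actBasis k 0ℤ ⟫ T + ⟪ g ⟫ (λ j → ⟪ χ j ⟫ T)      ≡⟨ cong (λ a → c * a + ⟪ g ⟫ (λ j → ⟪ χ j ⟫ T)) (trans (⟪⟫-χ-reflect k T) (cong -_ (⟪⟫-χ k T))) ⟨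
  c * ⟪ χ -[1+ suc k ] ⟫ T + ⟪ g ⟫ (λ j → ⟪ χ j ⟫ T)       ∎
  where
  open ≡-Reasoning
  lemma : ∀ c a → - c * a ≡ c * - a
  lemma = solve-∀

Lχ-cong : g ≃ h → Lχ g ≃ Lχ h
Lχ-cong {g} {h} p = mk≃ λ T → trans (⟪⟫-Lχ g T) (trans (at p _) (sym (⟪⟫-Lχ h T)))

Lχ-⊞ : ∀ g h → Lχ (g ⊞ h) ≃ Lχ g ⊞ Lχ h
Lχ-⊞ g h = mk≃ λ T → begin
  ⟪ Lχ (g ⊞ h) ⟫ T                                          ≡⟨ ⟪⟫-Lχ (g ⊞ h) T ⟩
  ⟪ g ⊞ h ⟫ (λ j → ⟪ χ j ⟫ T)                               ≡⟨ ⟪⟫-++ g h _ ⟩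
  ⟪ g ⟫ (λ j → ⟪ χ j ⟫ T) + ⟪ h ⟫ (λ j → ⟪ χ j ⟫ T)         ≡⟨ cong₂ _+_ (⟪⟫-Lχ g T) (⟪⟫-Lχ h T) ⟨
  ⟪ Lχ g ⟫ T + ⟪ Lχ h ⟫ T                                   ≡⟨ ⟪⟫-++ (Lχ g) (Lχ h) T ⟨
  ⟪ Lχ g ⊞ Lχ h ⟫ T                                         ∎
  where open ≡-Reasoning

actBasis-shift : ∀ i j → actBasis i j ≃ S j (actBasis i 0ℤ)
actBasis-shift i j = ≃-trans (≃-reflexive (cong (λ s → progression s (suc i)) (lemma j (+ i))))
                             (≃-sym (S-progression j (0ℤ - + i) (suc i)))
  where
  lemma : ∀ j i → j - i ≡ 0ℤ - i + j
  lemma = solve-∀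

act≃⋆character : ∀ a x → act a x ≃ x ⋆ character a
act≃⋆character [] x = ≃-sym (⋆-zeroʳ x)
act≃⋆character ((i , c) ∷ a) x = mk≃ λ T → begin
  ⟪ act ((i , c) ∷ a) x ⟫ T                                      ≡⟨ ⟪⟫-++ (acting x) (act a x) T ⟩
  ⟪ acting x ⟫ T + ⟪ act a x ⟫ T                                 ≡⟨ cong₂ _+_ (⟪⟫-acting x T) (at (act≃⋆character a x) T) ⟩
  ⟪ x ⟫ (λ j → c * ⟪ B ⟫ (λ k → T (k + j))) + ⟪ x ⋆ character a ⟫ T
                                                                 ≡⟨ cong (_+ _) (⟪⟫-cong x (λ j → sym (⟪⟫-scale c B _))) ⟩
  ⟪ x ⟫ (λ j → ⟪ scale c B ⟫ (λ k → T (k + j))) + ⟪ x ⋆ character a ⟫ T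
                                                                 ≡⟨ cong (_+ ⟪ x ⋆ character a ⟫ T) (⟪⟫-⋆ x (scale c B) T) ⟨
  ⟪ x ⋆ scale c B ⟫ T + ⟪ x ⋆ character a ⟫ T                    ≡⟨ trans (at (⋆-distribʳ x (scale c B) (character a)) T) (⟪⟫-++ (x ⋆ scale c B) (x ⋆ character a) T) ⟨
  ⟪ x ⋆ character ((i , c) ∷ a) ⟫ T                              ∎
  where
  open ≡-Reasoning
  B = actBasis i 0ℤ
  acting : Elt → Elt
  acting = concatMap (λ (j , d) → scale (c * d) (actBasis i j))
  ⟪⟫-acting : ∀ x T → ⟪ acting x ⟫ T ≡ ⟪ x ⟫ (λ j → c * ⟪ B ⟫ (λ k → T (k + j)))
  ⟪⟫-acting [] T = refl
  ⟪⟫-acting ((j , d) ∷ x) T = begin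
    ⟪ scale (c * d) (actBasis i j) ++ acting x ⟫ T                  ≡⟨ ⟪⟫-++ (scale (c * d) (actBasis i j)) (acting x) T ⟩
    ⟪ scale (c * d) (actBasis i j) ⟫ T + ⟪ acting x ⟫ T             ≡⟨ cong₂ _+_ (⟪⟫-scale (c * d) (actBasis i j) T) (⟪⟫-acting x T) ⟩
    c * d * ⟪ actBasis i j ⟫ T + ⟪ x ⟫ (λ j → c * ⟪ B ⟫ (λ k → T (k + j)))
                                                                    ≡⟨ cong (λ b → c * d * b + _) (trans (at (actBasis-shift i j) T) (⟪⟫-S j B T)) ⟩
    c * d * ⟪ B ⟫ (λ k → T (k + j)) + ⟪ x ⟫ (λ j → c * ⟪ B ⟫ (λ k → T (k + j)))
                                                                    ≡⟨ cong (_+ _) (lemma c d _) ⟩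
    d * (c * ⟪ B ⟫ (λ k → T (k + j))) + ⟪ x ⟫ (λ j → c * ⟪ B ⟫ (λ k → T (k + j))) ∎
    where
    lemma : ∀ c d b → c * d * b ≡ d * (c * b)
    lemma = solve-∀

·≃Lχ⋆ : ∀ g x → g · x ≃ Lχ g ⋆ x
·≃Lχ⋆ g x = ≃-trans (act≃⋆character (L g) x) (⋆-comm x (Lχ g))

χ-snoc : ∀ m → χ (+ suc m) ≃ S -1ℤ (χ (+ m)) ⊞ ht (+ suc m)
χ-snoc m = begin
  χ (+ suc m)                                                          ≈⟨ χ≃progression (suc m) ⟩
  progression (- + suc m) (suc (suc m))                                ≈⟨ progression-snoc (- + suc m) (suc m) ⟩
  progression (- + suc m) (suc m) ⊞ ht (- + suc m + + (2 ℕ.* suc m))  ≈⟨ ≃-reflexive (cong₂ (λ s j → progression s (suc m) ⊞ ht j) first last) ⟩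
  progression (- + m + -1ℤ) (suc m) ⊞ ht (+ suc m)                     ≈⟨ ⊞-congʳ (ht (+ suc m)) (S-progression -1ℤ (- + m) (suc m)) ⟨
  S -1ℤ (progression (- + m) (suc m)) ⊞ ht (+ suc m)                   ≈⟨ ⊞-congʳ (ht (+ suc m)) (S-cong -1ℤ (χ≃progression m)) ⟨
  S -1ℤ (χ (+ m)) ⊞ ht (+ suc m)                                       ∎
  where
  open ≃-Reasoning
  first : - + suc m ≡ - + m + -1ℤ
  first = lemma (+ m)
    where
    lemma : ∀ m → - (+ 1 + m) ≡ - m + -1ℤ
    lemma = solve-∀
  last : - + suc m + + (2 ℕ.* suc m) ≡ + suc m
  last = trans (cong (_+_ (- + suc m)) (+[2*]≡ (suc m))) (lemma (+ m))
    where
    lemma : ∀ m → - (+ 1 + m) + ((+ 1 + m) + (+ 1 + m)) ≡ + 1 + m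
    lemma = solve-∀

χ-cons : ∀ m → χ (+ suc m) ≃ ht (- + suc m) ⊞ S 1ℤ (χ (+ m))
χ-cons m = begin
  χ (+ suc m)                                        ≈⟨ χ≃progression (suc m) ⟩
  progression (- + suc m) (suc (suc m))              ≈⟨ progression-cons (- + suc m) (suc m) ⟩
  ht (- + suc m) ⊞ progression (- + suc m + + 2) (suc m)
                                                     ≈⟨ ≃-reflexive (cong (λ s → ht (- + suc m) ⊞ progression s (suc m)) (lemma (+ m))) ⟩
  ht (- + suc m) ⊞ progression (- + m + 1ℤ) (suc m)  ≈⟨ ⊞-congˡ (ht (- + suc m)) (S-progression 1ℤ (- + m) (suc m)) ⟨
  ht (- + suc m) ⊞ S 1ℤ (progression (- + m) (suc m)) ≈⟨ ⊞-congˡ (ht (- + suc m)) (S-cong 1ℤ (χ≃progression m)) ⟨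
  ht (- + suc m) ⊞ S 1ℤ (χ (+ m))                    ∎
  where
  open ≃-Reasoning
  lemma : ∀ m → - (+ 1 + m) + + 2 ≡ - m + 1ℤ
  lemma = solve-∀

-- For negative j this uses the conventions χ_(-1) = 0 and χ_(-j-2) = -χ_j built into L.
χ-rec : ∀ j → χ j ≃ S -1ℤ (χ (j - 1ℤ)) ⊞ ht j
χ-rec (+ zero) = ≃-refl
χ-rec (+ suc m) = χ-snoc m
χ-rec -[1+ zero ] = mk≃ λ T → begin
  0ℤ                                                 ≡⟨ ℤP.+-inverseˡ (T -1ℤ) ⟨
  - T -1ℤ + T -1ℤ                                    ≡⟨ cong₂ _+_ (trans (⟪⟫-χ-reflect 0 (λ j → T (j - 1ℤ)))
                                                                          (cong -_ (⟪⟫-ht 0ℤ (λ j → T (j - 1ℤ)))))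
                                                                   (⟪⟫-ht -1ℤ T) ⟨
  ⟪ χ -[1+ 1 ] ⟫ (λ j → T (j - 1ℤ)) + ⟪ ht -1ℤ ⟫ T   ≡⟨ cong (_+ ⟪ ht -1ℤ ⟫ T) (⟪⟫-S -1ℤ (χ -[1+ 1 ]) T) ⟨
  ⟪ S -1ℤ (χ -[1+ 1 ]) ⟫ T + ⟪ ht -1ℤ ⟫ T            ≡⟨ ⟪⟫-++ (S -1ℤ (χ -[1+ 1 ])) (ht -1ℤ) T ⟨
  ⟪ S -1ℤ (χ -[1+ 1 ]) ⊞ ht -1ℤ ⟫ T                  ∎
  where open ≡-Reasoning
χ-rec -[1+ suc m ] = mk≃ λ T → begin
  ⟪ χ -[1+ suc m ] ⟫ T                                        ≡⟨ ⟪⟫-χ-reflect m T ⟩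
  - ⟪ χ (+ m) ⟫ T                                             ≡⟨ lemma (⟪ χ (+ m) ⟫ T) (T -[1+ suc m ]) ⟩
  - (T -[1+ suc m ] + ⟪ χ (+ m) ⟫ T) + T -[1+ suc m ]         ≡⟨ cong (λ a → - a + T -[1+ suc m ]) (cons T) ⟨
  - ⟪ χ (+ suc m) ⟫ (λ j → T (j - 1ℤ)) + T -[1+ suc m ]       ≡⟨ cong (_+ T -[1+ suc m ]) (⟪⟫-χ-reflect (suc m) (λ j → T (j - 1ℤ))) ⟨
  ⟪ χ -[1+ suc (suc m) ] ⟫ (λ j → T (j - 1ℤ)) + T -[1+ suc m ] ≡⟨ cong₂ _+_ (⟪⟫-S -1ℤ (χ -[1+ suc (suc m) ]) T) (⟪⟫-ht -[1+ suc m ] T) ⟨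
  ⟪ S -1ℤ (χ -[1+ suc (suc m) ]) ⟫ T + ⟪ ht -[1+ suc m ] ⟫ T  ≡⟨ ⟪⟫-++ (S -1ℤ (χ -[1+ suc (suc m) ])) (ht -[1+ suc m ]) T ⟨
  ⟪ S -1ℤ (χ -[1+ suc (suc m) ]) ⊞ ht -[1+ suc m ] ⟫ T        ≡⟨ cong (λ n → ⟪ S -1ℤ (χ -[1+ suc (suc n) ]) ⊞ ht -[1+ suc m ] ⟫ T) (ℕP.+-identityʳ m) ⟨
  ⟪ S -1ℤ (χ (-[1+ suc m ] - 1ℤ)) ⊞ ht -[1+ suc m ] ⟫ T       ∎
  where
  open ≡-Reasoning
  lemma : ∀ a t → - a ≡ - (t + a) + t
  lemma = solve-∀
  cons : ∀ T → ⟪ χ (+ suc m) ⟫ (λ j → T (j - 1ℤ)) ≡ T -[1+ suc m ] + ⟪ χ (+ m) ⟫ T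
  cons T = begin
    ⟪ χ (+ suc m) ⟫ U                                      ≡⟨ at (χ-cons m) U ⟩
    ⟪ ht (- + suc m) ⊞ S 1ℤ (χ (+ m)) ⟫ U                  ≡⟨ ⟪⟫-++ (ht (- + suc m)) (S 1ℤ (χ (+ m))) U ⟩
    ⟪ ht (- + suc m) ⟫ U + ⟪ S 1ℤ (χ (+ m)) ⟫ U            ≡⟨ cong₂ _+_ (⟪⟫-ht (- + suc m) U) (⟪⟫-S 1ℤ (χ (+ m)) U) ⟩
    T (- + suc m - 1ℤ) + ⟪ χ (+ m) ⟫ (λ j → T (j + 1ℤ - 1ℤ))
                                                           ≡⟨ cong₂ _+_ (cong T (index₁ (+ m))) (⟪⟫-cong (χ (+ m)) (λ j → cong T (index₂ j))) ⟩
    T -[1+ suc m ] + ⟪ χ (+ m) ⟫ T                         ∎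
    where
    U = λ j → T (j - 1ℤ)
    index₁ : ∀ m → - (+ 1 + m) - 1ℤ ≡ - (+ 2 + m)
    index₁ = solve-∀
    index₂ : ∀ j → j + 1ℤ - 1ℤ ≡ j
    index₂ = solve-∀

Lχ-rec : ∀ g → Lχ g ≃ S -1ℤ (Lχ (S -1ℤ g)) ⊞ g
Lχ-rec g = mk≃ λ T → begin
  ⟪ Lχ g ⟫ T                                                           ≡⟨ ⟪⟫-Lχ g T ⟩
  ⟪ g ⟫ (λ j → ⟪ χ j ⟫ T)                                              ≡⟨ ⟪⟫-cong g (λ j → at (χ-rec j) T) ⟩
  ⟪ g ⟫ (λ j → ⟪ S -1ℤ (χ (j - 1ℤ)) ⊞ ht j ⟫ T)                         ≡⟨ ⟪⟫-cong g (λ j → trans (⟪⟫-++ (S -1ℤ (χ (j - 1ℤ))) (ht j) T)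
                                                                             (cong₂ _+_ (⟪⟫-S -1ℤ (χ (j - 1ℤ)) T) (⟪⟫-ht j T))) ⟩
  ⟪ g ⟫ (λ j → ⟪ χ (j - 1ℤ) ⟫ (λ i → T (i - 1ℤ)) + T j)               ≡⟨ ⟪⟫-+ g _ T ⟩
  ⟪ g ⟫ (λ j → ⟪ χ (j - 1ℤ) ⟫ (λ i → T (i - 1ℤ))) + ⟪ g ⟫ T           ≡⟨ cong (_+ ⟪ g ⟫ T) (⟪⟫-S -1ℤ g _) ⟨
  ⟪ S -1ℤ g ⟫ (λ j → ⟪ χ j ⟫ (λ i → T (i - 1ℤ))) + ⟪ g ⟫ T            ≡⟨ cong (_+ ⟪ g ⟫ T) (trans (⟪⟫-S -1ℤ (Lχ (S -1ℤ g)) T) (⟪⟫-Lχ (S -1ℤ g) _)) ⟨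
  ⟪ S -1ℤ (Lχ (S -1ℤ g)) ⟫ T + ⟪ g ⟫ T                                ≡⟨ ⟪⟫-++ (S -1ℤ (Lχ (S -1ℤ g))) g T ⟨
  ⟪ S -1ℤ (Lχ (S -1ℤ g)) ⊞ g ⟫ T                                      ∎
  where open ≡-Reasoning

·-cong : g ≃ g′ → h ≃ h′ → g · h ≃ g′ · h′
·-cong {g} {g′} {h} {h′} p q =
  ≃-trans (·≃Lχ⋆ g h) (≃-trans (⋆-cong (Lχ-cong p) q) (≃-sym (·≃Lχ⋆ g′ h′)))

·⊟S₋₁·S₋₁≃⋆ : ∀ g h → g · h ⊟ S -1ℤ g · S -1ℤ h ≃ g ⋆ h
·⊟S₋₁·S₋₁≃⋆ g h = begin
  g · h ⊟ S -1ℤ g · S -1ℤ h                          ≈⟨ ⊟-cong (·≃Lχ⋆ g h) (·≃Lχ⋆ (S -1ℤ g) (S -1ℤ h)) ⟩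
  Lχ g ⋆ h ⊟ Lχ (S -1ℤ g) ⋆ S -1ℤ h                  ≈⟨ ⊟-cong (≃-refl {Lχ g ⋆ h}) (≃-trans (⋆-S -1ℤ (Lχ (S -1ℤ g)) h) (≃-sym (S-⋆ -1ℤ (Lχ (S -1ℤ g)) h))) ⟩
  Lχ g ⋆ h ⊟ S -1ℤ (Lχ (S -1ℤ g)) ⋆ h                ≈⟨ ⋆-⊟-distribˡ (Lχ g) (S -1ℤ (Lχ (S -1ℤ g))) h ⟨
  (Lχ g ⊟ S -1ℤ (Lχ (S -1ℤ g))) ⋆ h                  ≈⟨ ⋆-cong (⊟-cong (Lχ-rec g) (≃-refl {S -1ℤ (Lχ (S -1ℤ g))})) (≃-refl {h}) ⟩
  (S -1ℤ (Lχ (S -1ℤ g)) ⊞ g ⊟ S -1ℤ (Lχ (S -1ℤ g))) ⋆ h ≈⟨ ⋆-cong (⊞-⊟-cancelˡ D g) (≃-refl {h}) ⟩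
  g ⋆ h                                              ∎
  where
  open ≃-Reasoning
  D = S -1ℤ (Lχ (S -1ℤ g))

W0-≃ : ∀ g₁ g₂ g₃ → W0 g₁ g₂ g₃ ≃ g₂ · (g₁ ⋆ g₃)
W0-≃ g₁ g₂ g₃ = ·-cong (≃-refl {g₂}) (·⊟S₋₁·S₋₁≃⋆ g₁ g₃)

E-suc : ∀ n → E (suc n) ≃ E n · (E n ⋆ E n)
E-suc n = ·-cong (≃-refl {E n}) (·⊟S₋₁·S₋₁≃⋆ (E n) (E n))

⋆-χ-suc : ∀ g k → g ⋆ χ (+ suc k) ≃ S -1ℤ (g ⋆ χ (+ k)) ⊞ S (+ suc k) g
⋆-χ-suc g k = begin
  g ⋆ χ (+ suc k)                            ≈⟨ ⋆-cong (≃-refl {g}) (χ-snoc k) ⟩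
  g ⋆ (S -1ℤ (χ (+ k)) ⊞ ht (+ suc k))       ≈⟨ ⋆-distribʳ g (S -1ℤ (χ (+ k))) (ht (+ suc k)) ⟩
  g ⋆ S -1ℤ (χ (+ k)) ⊞ g ⋆ ht (+ suc k)     ≈⟨ ⊞-cong (⋆-S -1ℤ g (χ (+ k))) (⋆-ht g (+ suc k)) ⟩
  S -1ℤ (g ⋆ χ (+ k)) ⊞ S (+ suc k) g        ∎
  where open ≃-Reasoning

S-χ-rec : ∀ m e → S m (χ e) ≃ S (m - 1ℤ) (χ (e - 1ℤ)) ⊞ ht (e + m)
S-χ-rec m e = begin
  S m (χ e)                                   ≈⟨ S-cong m (χ-rec e) ⟩
  S m (S -1ℤ (χ (e - 1ℤ)) ⊞ ht e)             ≈⟨ S-⊞ m (S -1ℤ (χ (e - 1ℤ))) (ht e) ⟩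
  S m (S -1ℤ (χ (e - 1ℤ))) ⊞ ht (e + m)       ≈⟨ ⊞-congʳ (ht (e + m)) (S-S m -1ℤ (χ (e - 1ℤ))) ⟩
  S (-1ℤ + m) (χ (e - 1ℤ)) ⊞ ht (e + m)       ≈⟨ ≃-reflexive (cong (λ k → S k (χ (e - 1ℤ)) ⊞ ht (e + m)) (ℤP.+-comm -1ℤ m)) ⟩
  S (m - 1ℤ) (χ (e - 1ℤ)) ⊞ ht (e + m)        ∎
  where open ≃-Reasoning

χ⋆χ-suc : ∀ k e → χ e ⋆ χ (+ suc k) ≃ χ (e - 1ℤ) ⋆ χ (+ k) ⊞ χ (e + + suc k)
χ⋆χ-suc zero e = begin
  χ e ⋆ χ 1ℤ                                               ≈⟨ ⋆-χ-suc (χ e) 0 ⟩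
  S -1ℤ (χ e ⋆ ht 0ℤ) ⊞ S 1ℤ (χ e)                         ≈⟨ ⊞-cong (S-cong -1ℤ (≃-trans (⋆-ht (χ e) 0ℤ) (S-zero (χ e)))) (S-χ-rec 1ℤ e) ⟩
  S -1ℤ (χ e) ⊞ (S 0ℤ (χ (e - 1ℤ)) ⊞ ht (e + 1ℤ))          ≈⟨ x⊞yz≃y⊞xz (S -1ℤ (χ e)) (S 0ℤ (χ (e - 1ℤ))) (ht (e + 1ℤ)) ⟩
  S 0ℤ (χ (e - 1ℤ)) ⊞ (S -1ℤ (χ e) ⊞ ht (e + 1ℤ))          ≈⟨ ⊞-cong (⋆-ht (χ (e - 1ℤ)) 0ℤ) (≃-reflexive (cong (λ j → S -1ℤ (χ j) ⊞ ht (e + 1ℤ)) (lemma e))) ⟨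
  χ (e - 1ℤ) ⋆ ht 0ℤ ⊞ (S -1ℤ (χ (e + 1ℤ - 1ℤ)) ⊞ ht (e + 1ℤ)) ≈⟨ ⊞-congˡ (χ (e - 1ℤ) ⋆ ht 0ℤ) (χ-rec (e + 1ℤ)) ⟨
  χ (e - 1ℤ) ⋆ χ 0ℤ ⊞ χ (e + 1ℤ)                           ∎
  where
  open ≃-Reasoning
  lemma : ∀ e → e + 1ℤ - 1ℤ ≡ e
  lemma = solve-∀
χ⋆χ-suc (suc k) e = begin
  χ e ⋆ χ (+ suc (suc k))                                              ≈⟨ ⋆-χ-suc (χ e) (suc k) ⟩
  S -1ℤ (χ e ⋆ χ (+ suc k)) ⊞ S (+ suc (suc k)) (χ e)                  ≈⟨ ⊞-cong (S-cong -1ℤ (χ⋆χ-suc k e)) (S-χ-rec (+ suc (suc k)) e) ⟩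
  S -1ℤ (A ⊞ χ (e + + suc k)) ⊞ (S (+ suc k) (χ (e - 1ℤ)) ⊞ ht (e + + suc (suc k)))
                                                                       ≈⟨ ⊞-congʳ _ (S-⊞ -1ℤ A (χ (e + + suc k))) ⟩
  (S -1ℤ A ⊞ S -1ℤ (χ (e + + suc k))) ⊞ (S (+ suc k) (χ (e - 1ℤ)) ⊞ ht (e + + suc (suc k)))
                                                                       ≈⟨ ⊞-interchange (S -1ℤ A) _ _ _ ⟩
  (S -1ℤ A ⊞ S (+ suc k) (χ (e - 1ℤ))) ⊞ (S -1ℤ (χ (e + + suc k)) ⊞ ht (e + + suc (suc k)))
                                                                       ≈⟨ ⊞-cong (⋆-χ-suc (χ (e - 1ℤ)) k) (≃-trans (χ-rec (e + + suc (suc k))) (≃-reflexive (cong (λ j → S -1ℤ (χ j) ⊞ ht (e + + suc (suc k))) (lemma e (+ k))))) ⟨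
  χ (e - 1ℤ) ⋆ χ (+ suc k) ⊞ χ (e + + suc (suc k))                      ∎
  where
  open ≃-Reasoning
  A = χ (e - 1ℤ) ⋆ χ (+ k)
  lemma : ∀ e k → e + (+ 2 + k) - 1ℤ ≡ e + (+ 1 + k)
  lemma = solve-∀

Lχ-S-χ : ∀ k e → Lχ (S e (χ (+ k))) ≃ χ e ⋆ χ (+ k)
Lχ-S-χ zero e = begin
  χ (0ℤ + e)      ≈⟨ ≃-reflexive (cong χ (ℤP.+-identityˡ e)) ⟩
  χ e             ≈⟨ S-zero (χ e) ⟨
  S 0ℤ (χ e)      ≈⟨ ⋆-ht (χ e) 0ℤ ⟨
  χ e ⋆ ht 0ℤ     ∎
  where open ≃-Reasoning
Lχ-S-χ (suc k) e = begin
  Lχ (S e (χ (+ suc k)))                                  ≈⟨ Lχ-cong (S-cong e (χ-snoc k)) ⟩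
  Lχ (S e (S -1ℤ (χ (+ k)) ⊞ ht (+ suc k)))               ≈⟨ Lχ-cong (S-⊞ e (S -1ℤ (χ (+ k))) (ht (+ suc k))) ⟩
  Lχ (S e (S -1ℤ (χ (+ k))) ⊞ ht (+ suc k + e))           ≈⟨ Lχ-⊞ (S e (S -1ℤ (χ (+ k)))) (ht (+ suc k + e)) ⟩
  Lχ (S e (S -1ℤ (χ (+ k)))) ⊞ χ (+ suc k + e)            ≈⟨ ⊞-cong (Lχ-cong (≃-trans (S-S e -1ℤ (χ (+ k))) (≃-reflexive (cong (λ j → S j (χ (+ k))) (ℤP.+-comm -1ℤ e)))))
                                                                    (≃-reflexive (cong χ (ℤP.+-comm (+ suc k) e))) ⟩
  Lχ (S (e - 1ℤ) (χ (+ k))) ⊞ χ (e + + suc k)             ≈⟨ ⊞-congʳ (χ (e + + suc k)) (Lχ-S-χ k (e - 1ℤ)) ⟩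
  χ (e - 1ℤ) ⋆ χ (+ k) ⊞ χ (e + + suc k)                  ≈⟨ χ⋆χ-suc k e ⟨
  χ e ⋆ χ (+ suc k)                                       ∎
  where open ≃-Reasoning

-- Sums of characters and the Laurent-polynomial form of R(0)

chis : List ℕ → Elt
chis = concatMap (λ k → χ (+ k))

monomials : List ℕ → Elt
monomials = concatMap (λ a → ht (+ a))

IsCharSum : Elt → Set
IsCharSum g = Σ[ ks ∈ List ℕ ] g ≃ chis ks

-- The shape of x ^ -c h̃(M) for M ∈ R(c) (R-multiset): monomials x ^ a with a ≥ 0 and
-- characters χ_k.
IsR₀ : Elt → Set
IsR₀ g = Σ[ as ∈ List ℕ ] Σ[ ks ∈ List ℕ ] g ≃ monomials as ⊞ chis ks

record ⊞-Closed (C : Elt → Set) : Set where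
  field
    ≃-resp    : ∀ {g h} → g ≃ h → C h → C g
    []-closed : C []
    ⊞-closed  : ∀ {g h} → C g → C h → C (g ⊞ h)

open MonoidMorphisms (CommutativeMonoid.rawMonoid ⊞-commutativeMonoid)
                     (CommutativeMonoid.rawMonoid ⊞-commutativeMonoid)
  using (IsMonoidHomomorphism)

concatMap-closed : ∀ {A : Set} {C Φ} {f : A → Elt} → ⊞-Closed C → IsMonoidHomomorphism Φ →
                   (∀ x → C (Φ (f x))) → ∀ xs → C (Φ (concatMap f xs))
concatMap-closed C-closed Φ-hom f∈C [] = ≃-resp ε-homo []-closed
  where open ⊞-Closed C-closed; open IsMonoidHomomorphism Φ-hom
concatMap-closed {f = f} C-closed Φ-hom f∈C (x ∷ xs) =
  ≃-resp (homo (f x) (concatMap f xs)) (⊞-closed (f∈C x) (concatMap-closed C-closed Φ-hom f∈C xs))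
  where open ⊞-Closed C-closed; open IsMonoidHomomorphism Φ-hom

⋆-homˡ : ∀ h → IsMonoidHomomorphism (_⋆ h)
⋆-homˡ h = record
  { isMagmaHomomorphism = record
    { isRelHomomorphism = record { cong = λ p → ⋆-cong p (≃-refl {h}) }
    ; homo              = λ g g′ → ⋆-distribˡ g g′ h
    }
  ; ε-homo = ≃-refl
  }

⋆-homʳ : ∀ g → IsMonoidHomomorphism (g ⋆_)
⋆-homʳ g = record
  { isMagmaHomomorphism = record
    { isRelHomomorphism = record { cong = ⋆-cong (≃-refl {g}) }
    ; homo              = ⋆-distribʳ g
    }
  ; ε-homo = ⋆-zeroʳ g
  }

Lχ∘S-hom : ∀ e → IsMonoidHomomorphism (λ g → Lχ (S e g))
Lχ∘S-hom e = record
  { isMagmaHomomorphism = record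
    { isRelHomomorphism = record { cong = Lχ-cong ∘ S-cong e }
    ; homo              = λ g h → ≃-trans (Lχ-cong (S-⊞ e g h)) (Lχ-⊞ (S e g) (S e h))
    }
  ; ε-homo = ≃-refl
  }

charSum-closed : ⊞-Closed IsCharSum
charSum-closed = record
  { ≃-resp    = λ { p (ks , q) → ks , ≃-trans p q }
  ; []-closed = [] , ≃-refl
  ; ⊞-closed  = λ { (ks , p) (ls , q) → ks ++ ls , ≃-trans (⊞-cong p q) (≃-sym (≃-reflexive (List.concatMap-++ _ ks ls))) }
  }

R₀-closed : ⊞-Closed IsR₀
R₀-closed = record
  { ≃-resp    = λ { p (as , ks , q) → as , ks , ≃-trans p q }
  ; []-closed = [] , [] , ≃-refl
  ; ⊞-closed  = λ { {g} {h} (as , ks , p) (bs , ls , q) → as ++ bs , ks ++ ls , (begin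
      g ⊞ h                                                            ≈⟨ ⊞-cong p q ⟩
      (monomials as ⊞ chis ks) ⊞ (monomials bs ⊞ chis ls)              ≈⟨ ⊞-interchange (monomials as) (chis ks) (monomials bs) (chis ls) ⟩
      (monomials as ⊞ monomials bs) ⊞ (chis ks ⊞ chis ls)              ≈⟨ ≃-reflexive (cong₂ _⊞_ (List.concatMap-++ _ as bs) (List.concatMap-++ _ ks ls)) ⟨
      monomials (as ++ bs) ⊞ chis (ks ++ ls)                           ∎) }
  }
  where open ≃-Reasoning

χ-charSum : ∀ k → IsCharSum (χ (+ k))
χ-charSum k = k ∷ [] , ≃-sym (⊞-identityʳ (χ (+ k)))

charSum⇒R₀ : IsCharSum g → IsR₀ g
charSum⇒R₀ (ks , p) = [] , ks , p

ht-R₀ : ∀ a → IsR₀ (ht (+ a))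
ht-R₀ a = a ∷ [] , [] , ≃-sym (⊞-identityʳ (ht (+ a) ⊞ []))

χ⋆χ-charSum : ∀ a b → IsCharSum (χ (+ a) ⋆ χ (+ b))
χ⋆χ-charSum a zero = ≃-resp (≃-trans (⋆-ht (χ (+ a)) 0ℤ) (S-zero (χ (+ a)))) (χ-charSum a)
  where open ⊞-Closed charSum-closed
χ⋆χ-charSum zero (suc b) =
  ≃-resp (⋆-comm (χ 0ℤ) (χ (+ suc b))) (χ⋆χ-charSum (suc b) zero)
  where open ⊞-Closed charSum-closed
χ⋆χ-charSum (suc a) (suc b) =
  ≃-resp (χ⋆χ-suc b (+ suc a)) (⊞-closed (χ⋆χ-charSum a b) (χ-charSum (suc a ℕ.+ suc b)))
  where open ⊞-Closed charSum-closed

charSum-⋆ : IsCharSum g → IsCharSum h → IsCharSum (g ⋆ h)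
charSum-⋆ (ks , p) (ls , q) =
  ≃-resp (⋆-cong p q)
    (concatMap-closed charSum-closed (⋆-homˡ (chis ls))
      (λ k → concatMap-closed charSum-closed (⋆-homʳ (χ (+ k))) (χ⋆χ-charSum k) ls) ks)
  where open ⊞-Closed charSum-closed

S-χ-R₀ : ∀ m k → IsR₀ (S (+ m) (χ (+ k)))
S-χ-R₀ zero k = ≃-resp (S-zero (χ (+ k))) (charSum⇒R₀ (χ-charSum k))
  where open ⊞-Closed R₀-closed
S-χ-R₀ (suc m) zero = ht-R₀ (suc m)
S-χ-R₀ (suc m) (suc k) =
  ≃-resp (S-χ-rec (+ suc m) (+ suc k)) (⊞-closed (S-χ-R₀ m k) (ht-R₀ (suc k ℕ.+ suc m)))
  where open ⊞-Closed R₀-closed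

R₀-⋆-charSum : IsR₀ g → IsCharSum h → IsR₀ (g ⋆ h)
R₀-⋆-charSum (as , ks , p) (ls , q) =
  ≃-resp (≃-trans (⋆-cong p q) (⋆-distribˡ (monomials as) (chis ks) (chis ls)))
    (⊞-closed
      (concatMap-closed R₀-closed (⋆-homˡ (chis ls))
        (λ a → concatMap-closed R₀-closed (⋆-homʳ (ht (+ a)))
          (λ l → ≃-resp (≃-trans (⋆-comm (ht (+ a)) (χ (+ l))) (⋆-ht (χ (+ l)) (+ a))) (S-χ-R₀ a l)) ls) as)
      (charSum⇒R₀ (charSum-⋆ (ks , ≃-refl) (ls , ≃-refl))))
  where open ⊞-Closed R₀-closed

charSum-⋆-R₀ : IsCharSum g → IsR₀ h → IsR₀ (g ⋆ h)
charSum-⋆-R₀ {g} {h} p q = ≃-resp (⋆-comm g h) (R₀-⋆-charSum q p)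
  where open ⊞-Closed R₀-closed

Lχ-S-R₀ : ∀ e → IsR₀ g → IsCharSum (Lχ (S (+ e) g))
Lχ-S-R₀ e (as , ks , p) =
  ≃-resp (≃-trans (Lχ-cong (S-cong (+ e) p)) (homo (monomials as) (chis ks)))
    (⊞-closed (concatMap-closed charSum-closed (Lχ∘S-hom (+ e)) (λ a → χ-charSum (a ℕ.+ e)) as)
              (concatMap-closed charSum-closed (Lχ∘S-hom (+ e))
                (λ k → ≃-resp (Lχ-S-χ k (+ e)) (χ⋆χ-charSum e k)) ks))
  where
  open ⊞-Closed charSum-closed
  open IsMonoidHomomorphism (Lχ∘S-hom (+ e))

·-distribʳ : ∀ g h k → g · (h ⊞ k) ≃ g · h ⊞ g · k
·-distribʳ g h k = begin
  g · (h ⊞ k)                  ≈⟨ ·≃Lχ⋆ g (h ⊞ k) ⟩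
  Lχ g ⋆ (h ⊞ k)               ≈⟨ ⋆-distribʳ (Lχ g) h k ⟩
  Lχ g ⋆ h ⊞ Lχ g ⋆ k          ≈⟨ ⊞-cong (·≃Lχ⋆ g h) (·≃Lχ⋆ g k) ⟨
  g · h ⊞ g · k                ∎
  where open ≃-Reasoning

nextF : Elt → Elt → Elt
nextF e f = e · (e ⋆ S -1ℤ e) ⊞ scale (+ 2) (e · (e ⋆ f)) ⊞ f · (e ⋆ e)

nextF-cong : g ≃ g′ → h ≃ h′ → nextF g h ≃ nextF g′ h′
nextF-cong p q =
  ⊞-cong (⊞-cong (·-cong p (⋆-cong p (S-cong -1ℤ p))) (scale-cong (+ 2) (·-cong p (⋆-cong p q))))
         (·-cong q (⋆-cong p p))

F-suc : ∀ n → F (suc n) ≃ nextF (E n) (F n)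
F-suc n = begin
  F (suc n)                                                  ≈⟨ ⊞-cong (⊞-cong (W0-≃ e e (f ⊞ S -1ℤ e)) (W0-≃ e f e)) (W0-≃ f e e) ⟩
  e · (e ⋆ (f ⊞ S -1ℤ e)) ⊞ f · (e ⋆ e) ⊞ e · (f ⋆ e)       ≈⟨ ⊞-cong (⊞-congʳ (f · (e ⋆ e)) (≃-trans (·-cong (≃-refl {e}) (⋆-distribʳ e f (S -1ℤ e))) (·-distribʳ e (e ⋆ f) (e ⋆ S -1ℤ e))))
                                                                        (·-cong (≃-refl {e}) (⋆-comm f e)) ⟩
  (e · (e ⋆ f) ⊞ e · (e ⋆ S -1ℤ e)) ⊞ f · (e ⋆ e) ⊞ e · (e ⋆ f)
                                                             ≈⟨ solve 3 (λ a b c → ((b ∙ a) ∙ c) ∙ b ⊜ (a ∙ (b ∙ b)) ∙ c) ≃-refl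
                                                                  (e · (e ⋆ S -1ℤ e)) (e · (e ⋆ f)) (f · (e ⋆ e)) ⟩
  e · (e ⋆ S -1ℤ e) ⊞ (e · (e ⋆ f) ⊞ e · (e ⋆ f)) ⊞ f · (e ⋆ e)
                                                             ≈⟨ ⊞-congʳ (f · (e ⋆ e)) (⊞-congˡ (e · (e ⋆ S -1ℤ e)) (scale-two (e · (e ⋆ f)))) ⟨
  nextF e f                                                  ∎
  where
  open ≃-Reasoning
  e = E n
  f = F n

-- The shape invariant

record Shape (e : ℕ) (G H : Elt) : Set where
  field
    P         : Elt
    P-charSum : IsCharSum P
    G≃        : G ≃ S (+ suc e) P
    Q         : Elt
    Q-R₀      : IsR₀ Q
    H≃        : H ≃ S (+ e) Q

shape-resp : ∀ {e} → g ≃ g′ → h ≃ h′ → Shape e g′ h′ → Shape e g h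
shape-resp p q s = record
  { P = P ; P-charSum = P-charSum ; G≃ = ≃-trans p G≃
  ; Q = Q ; Q-R₀ = Q-R₀ ; H≃ = ≃-trans q H≃ }
  where open Shape s

·-S : ∀ k g h → g · S k h ≃ S k (Lχ g ⋆ h)
·-S k g h = ≃-trans (·≃Lχ⋆ g (S k h)) (⋆-S k (Lχ g) h)

S-scale : ∀ k a g → S k (scale a g) ≃ scale a (S k g)
S-scale k a g = mk≃ λ T → begin
  ⟪ S k (scale a g) ⟫ T            ≡⟨ ⟪⟫-S k (scale a g) T ⟩
  ⟪ scale a g ⟫ (λ j → T (j + k))  ≡⟨ ⟪⟫-scale a g _ ⟩
  a * ⟪ g ⟫ (λ j → T (j + k))      ≡⟨ cong (a *_) (⟪⟫-S k g T) ⟨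
  a * ⟪ S k g ⟫ T                  ≡⟨ ⟪⟫-scale a (S k g) T ⟨
  ⟪ scale a (S k g) ⟫ T            ∎
  where open ≡-Reasoning

-- All three terms of nextF G H have the factor x ^ ((e + 1) + e); the extra x in G ⋆ G
-- stays with P ⋆ P, which is why the new Q contains x P P.
shape-step : ∀ {e G H} → Shape e G H → Shape (suc e ℕ.+ e) (G · (G ⋆ G)) (nextF G H)
shape-step {e} {G} {H} s = record
  { P = A
  ; P-charSum = A-charSum
  ; G≃ = begin
      G · (G ⋆ G)               ≈⟨ ·-cong (≃-refl {G}) G⋆G ⟩
      G · S k (S 1ℤ (P ⋆ P))    ≈⟨ ·-S k G (S 1ℤ (P ⋆ P)) ⟩
      S k (Lχ G ⋆ S 1ℤ (P ⋆ P)) ≈⟨ S-cong k (⋆-S 1ℤ (Lχ G) (P ⋆ P)) ⟩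
      S k (S 1ℤ A)              ≈⟨ S-S k 1ℤ A ⟩
      S (1ℤ + k) A              ∎
  ; Q = A ⊞ scale (+ 2) B ⊞ C
  ; Q-R₀ = ⊞-closed (⊞-closed (charSum⇒R₀ A-charSum) (≃-resp (scale-two B) (⊞-closed B-R₀ B-R₀))) C-R₀
  ; H≃ = begin
      nextF G H                                                  ≈⟨ ⊞-cong (⊞-cong (·-cong (≃-refl {G}) G⋆S₋₁G)
                                                                                     (scale-cong (+ 2) (·-cong (≃-refl {G}) G⋆H)))
                                                                           (·-cong (≃-refl {H}) G⋆G) ⟩
      G · S k (P ⋆ P) ⊞ scale (+ 2) (G · S k (P ⋆ Q)) ⊞ H · S k (S 1ℤ (P ⋆ P))
                                                                 ≈⟨ ⊞-cong (⊞-cong (·-S k G (P ⋆ P)) (scale-cong (+ 2) (·-S k G (P ⋆ Q))))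
                                                                           (·-S k H (S 1ℤ (P ⋆ P))) ⟩
      S k A ⊞ scale (+ 2) (S k B) ⊞ S k C                       ≈⟨ ⊞-congʳ (S k C) (⊞-congˡ (S k A) (S-scale k (+ 2) B)) ⟨
      S k A ⊞ S k (scale (+ 2) B) ⊞ S k C                       ≈⟨ ⊞-congʳ (S k C) (S-⊞ k A (scale (+ 2) B)) ⟨
      S k (A ⊞ scale (+ 2) B) ⊞ S k C                           ≈⟨ S-⊞ k (A ⊞ scale (+ 2) B) C ⟨
      S k (A ⊞ scale (+ 2) B ⊞ C)                               ∎
  }
  where
  open ≃-Reasoning
  open Shape s
  open ⊞-Closed R₀-closed
  a = + suc e
  k = a + + e
  A = Lχ G ⋆ (P ⋆ P)
  B = Lχ G ⋆ (P ⋆ Q)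
  C = Lχ H ⋆ S 1ℤ (P ⋆ P)
  LG-charSum : IsCharSum (Lχ G)
  LG-charSum = ⊞-Closed.≃-resp charSum-closed (Lχ-cong G≃) (Lχ-S-R₀ (suc e) (charSum⇒R₀ P-charSum))
  LH-charSum : IsCharSum (Lχ H)
  LH-charSum = ⊞-Closed.≃-resp charSum-closed (Lχ-cong H≃) (Lχ-S-R₀ e Q-R₀)
  PP-charSum : IsCharSum (P ⋆ P)
  PP-charSum = charSum-⋆ P-charSum P-charSum
  A-charSum : IsCharSum A
  A-charSum = charSum-⋆ LG-charSum PP-charSum
  B-R₀ : IsR₀ B
  B-R₀ = charSum-⋆-R₀ LG-charSum (charSum-⋆-R₀ P-charSum Q-R₀)
  C-R₀ : IsR₀ C
  C-R₀ = charSum-⋆-R₀ LH-charSum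
           (≃-resp (≃-trans (≃-sym (⋆-ht (P ⋆ P) 1ℤ)) (⋆-comm (P ⋆ P) (ht 1ℤ)))
                   (R₀-⋆-charSum (ht-R₀ 1) PP-charSum))
  G⋆G : G ⋆ G ≃ S k (S 1ℤ (P ⋆ P))
  G⋆G = begin
    G ⋆ G                 ≈⟨ ⋆-cong G≃ G≃ ⟩
    S a P ⋆ S a P         ≈⟨ S-⋆-S a a P P ⟩
    S (a + a) (P ⋆ P)     ≈⟨ ≃-reflexive (cong (λ m → S (+ suc m) (P ⋆ P)) (ℕP.+-suc e e)) ⟩
    S (1ℤ + k) (P ⋆ P)    ≈⟨ S-S k 1ℤ (P ⋆ P) ⟨
    S k (S 1ℤ (P ⋆ P))    ∎
  G⋆S₋₁G : G ⋆ S -1ℤ G ≃ S k (P ⋆ P)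
  G⋆S₋₁G = ≃-trans (⋆-cong G≃ (≃-trans (S-cong -1ℤ G≃) (S-S -1ℤ a P))) (S-⋆-S a (+ e) P P)
  G⋆H : G ⋆ H ≃ S k (P ⋆ Q)
  G⋆H = ≃-trans (⋆-cong G≃ H≃) (S-⋆-S a (+ e) P Q)

F-exponent : ℕ → ℕ
F-exponent zero = 1
F-exponent (suc n) = suc (F-exponent n) ℕ.+ F-exponent n

shape : ∀ n → Shape (F-exponent n) (E n) (F n)
shape zero = record
  { P = χ 0ℤ ; P-charSum = χ-charSum 0 ; G≃ = ≃-refl
  ; Q = [] ; Q-R₀ = ⊞-Closed.[]-closed R₀-closed ; H≃ = ≃-refl }
shape (suc n) = shape-resp (E-suc n) (F-suc n) (shape-step (shape n))

F-exponent≡2^[1+n]-1 : ∀ n → + F-exponent n ≡ + (2 ^ suc n) - 1ℤ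
F-exponent≡2^[1+n]-1 zero = refl
F-exponent≡2^[1+n]-1 (suc n) = begin
  1ℤ + (+ F-exponent n + + F-exponent n)                  ≡⟨ cong (λ a → 1ℤ + (a + a)) (F-exponent≡2^[1+n]-1 n) ⟩
  1ℤ + ((+ (2 ^ suc n) - 1ℤ) + (+ (2 ^ suc n) - 1ℤ))      ≡⟨ lemma (+ (2 ^ suc n)) ⟩
  + (2 ^ suc n) + + (2 ^ suc n) - 1ℤ                      ≡⟨ cong (_- 1ℤ) (+[2*]≡ (2 ^ suc n)) ⟨
  + (2 ^ suc (suc n)) - 1ℤ                                ∎
  where
  open ≡-Reasoning
  lemma : ∀ x → 1ℤ + ((x - 1ℤ) + (x - 1ℤ)) ≡ x + x - 1ℤ
  lemma = solve-∀

hM-translate : ∀ a N → hM (map (_+_ a) N) ≃ S a (hM N)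
hM-translate a N = ≃-reflexive (begin
  hM (map (_+_ a) N)                       ≡⟨ List.map-∘ N ⟨
  map (λ b → (a + b , 1ℤ)) N               ≡⟨ List.map-cong (λ b → cong (_, 1ℤ) (ℤP.+-comm a b)) N ⟩
  map (λ b → (b + a , 1ℤ)) N               ≡⟨ List.map-∘ N ⟩
  S a (hM N)                               ∎)
  where open ≡-Reasoning

scale-one : ∀ g → scale 1ℤ g ≃ g
scale-one g = mk≃ λ T → trans (⟪⟫-scale 1ℤ g T) (ℤP.*-identityˡ _)

hM-⊕ : ∀ M N → hM (M ⊕ N) ≃ hM M ⋆ hM N
hM-⊕ [] N = ≃-refl
hM-⊕ (a ∷ M) N = begin
  hM (map (_+_ a) N ++ M ⊕ N)             ≈⟨ ≃-reflexive (List.map-++ _ (map (_+_ a) N) (M ⊕ N)) ⟩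
  hM (map (_+_ a) N) ⊞ hM (M ⊕ N)         ≈⟨ ⊞-cong (≃-trans (hM-translate a N) (≃-sym (scale-one (S a (hM N))))) (hM-⊕ M N) ⟩
  scale 1ℤ (S a (hM N)) ⊞ hM M ⋆ hM N     ∎
  where open ≃-Reasoning

hM-SM : ∀ i M → hM (SM i M) ≃ S i (hM M)
hM-SM i M = ≃-trans (hM-⊕ M (i ∷ [])) (⋆-ht (hM M) i)

nextF-hM : ∀ M₀ M₁ → nextF (hM M₀) (hM M₁) ≃
  hM M₀ · hM (M₀ ⊕ SM -1ℤ M₀) ⊞ scale (+ 2) (hM M₀ · hM (M₀ ⊕ M₁)) ⊞ hM M₁ · hM (M₀ ⊕ M₀)
nextF-hM M₀ M₁ = ⊞-cong
  (⊞-cong (·-cong (≃-refl {hM M₀}) (≃-sym (≃-trans (hM-⊕ M₀ (SM -1ℤ M₀)) (⋆-cong (≃-refl {hM M₀}) (hM-SM -1ℤ M₀)))))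
          (scale-cong (+ 2) (·-cong (≃-refl {hM M₀}) (≃-sym (hM-⊕ M₀ M₁)))))
  (·-cong (≃-refl {hM M₁}) (≃-sym (hM-⊕ M₀ M₀)))

hM-interval : ∀ c n → hM (interval c n) ≃ S c (χ (+ n))
hM-interval c n = begin
  hM (interval c n)                        ≈⟨ ≃-reflexive (List.map-∘ (upTo (suc n))) ⟨
  progression (c - + n) (suc n)            ≈⟨ ≃-reflexive (cong (λ s → progression s (suc n)) (ℤP.+-comm c (- + n))) ⟩
  progression (- + n + c) (suc n)          ≈⟨ S-progression c (- + n) (suc n) ⟨
  S c (progression (- + n) (suc n))        ≈⟨ S-cong c (χ≃progression n) ⟨
  S c (χ (+ n))                            ∎
  where open ≃-Reasoning

hM-intervals : ∀ c ks → hM (concatMap (interval c) ks) ≃ S c (chis ks)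
hM-intervals c [] = ≃-refl
hM-intervals c (k ∷ ks) = begin
  hM (interval c k ++ concatMap (interval c) ks)      ≈⟨ ≃-reflexive (List.map-++ _ (interval c k) _) ⟩
  hM (interval c k) ⊞ hM (concatMap (interval c) ks)  ≈⟨ ⊞-cong (hM-interval c k) (hM-intervals c ks) ⟩
  S c (χ (+ k)) ⊞ S c (chis ks)                       ≈⟨ S-⊞ c (χ (+ k)) (chis ks) ⟨
  S c (chis (k ∷ ks))                                 ∎
  where open ≃-Reasoning

hM-shifted : ∀ c as → hM (map (λ a → c + + a) as) ≃ S c (monomials as)
hM-shifted c [] = ≃-refl
hM-shifted c (a ∷ as) = ⊞-cong (≃-reflexive (cong ht (ℤP.+-comm c (+ a)))) (hM-shifted c as)

-- χ₀ = x ⁰ is moved to the monomials, since R(c) only allows intervals of radius ≥ 1.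
chis-split : ∀ ks → Σ[ bs ∈ List ℕ ] Σ[ ks′ ∈ List ℕ ] All (1 ℕ.≤_) ks′ × chis ks ≃ monomials bs ⊞ chis ks′
chis-split [] = [] , [] , [] , ≃-refl
chis-split (zero ∷ ks) with chis-split ks
... | bs , ks′ , ks′≥1 , p = 0 ∷ bs , ks′ , ks′≥1 ,
  ≃-trans (⊞-congˡ (ht 0ℤ) p) (≃-sym (⊞-assoc (ht 0ℤ) (monomials bs) (chis ks′)))
chis-split (suc k ∷ ks) with chis-split ks
... | bs , ks′ , ks′≥1 , p = bs , suc k ∷ ks′ , ℕ.s≤s ℕ.z≤n ∷ ks′≥1 ,
  ≃-trans (⊞-congˡ (χ (+ suc k)) p) (x⊞yz≃y⊞xz (χ (+ suc k)) (monomials bs) (chis ks′))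

R-multiset : ∀ c {Q} → IsR₀ Q → Σ[ M ∈ Multiset ] R c M × hM M ≃ S c Q
R-multiset c {Q} (as , ks , Q≃) with chis-split ks
... | bs , ks′ , ks′≥1 , ks≃ = ms ++ concatMap (interval c) ks′ ,
  (ms , ks′ , ms≥c , ks′≥1 , λ _ → refl) , (begin
    hM (ms ++ concatMap (interval c) ks′)                 ≈⟨ ≃-reflexive (List.map-++ _ ms _) ⟩
    hM ms ⊞ hM (concatMap (interval c) ks′)               ≈⟨ ⊞-cong (hM-shifted c (as ++ bs)) (hM-intervals c ks′) ⟩
    S c (monomials (as ++ bs)) ⊞ S c (chis ks′)           ≈⟨ S-⊞ c (monomials (as ++ bs)) (chis ks′) ⟨
    S c (monomials (as ++ bs) ⊞ chis ks′)                 ≈⟨ S-cong c (begin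
      monomials (as ++ bs) ⊞ chis ks′                       ≈⟨ ⊞-congʳ (chis ks′) (≃-reflexive (List.concatMap-++ _ as bs)) ⟩
      monomials as ⊞ monomials bs ⊞ chis ks′                ≈⟨ ⊞-assoc (monomials as) (monomials bs) (chis ks′) ⟩
      monomials as ⊞ (monomials bs ⊞ chis ks′)              ≈⟨ ⊞-congˡ (monomials as) ks≃ ⟨
      monomials as ⊞ chis ks                                ≈⟨ Q≃ ⟨
      Q                                                     ∎) ⟩
    S c Q                                                 ∎)
  where
  open ≃-Reasoning
  ms = map (λ a → c + + a) (as ++ bs)
  ms≥c : All (c ℤ.≤_) ms
  ms≥c = All.map⁺ (All.universal (λ a → ℤP.i≤i+j c (+ a)) (as ++ bs))

theorem4 : (n : ℕ) → (M₀ : Multiset) → hM M₀ ≈ E n →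
    Σ[ M₁ ∈ Multiset ] R (+ (2 ^ suc n) - + 1) M₁ × F n ≈ hM M₁ ×
      F (suc n) ≈ act (L (hM M₀)) (hM (M₀ ⊕ SM (- + 1) M₀))
                  ⊞ scale (+ 2) (act (L (hM M₀)) (hM (M₀ ⊕ M₁)))
                  ⊞ act (L (hM M₁)) (hM (M₀ ⊕ M₀))
theorem4 n M₀ M₀≈E with R-multiset (+ (2 ^ suc n) - 1ℤ) (Shape.Q-R₀ (shape n))
... | M₁ , M₁∈R , M₁≃ = M₁ , M₁∈R , ≃⇒≈ F≃M₁ , ≃⇒≈ (begin
    F (suc n)                 ≈⟨ F-suc n ⟩
    nextF (E n) (F n)         ≈⟨ nextF-cong E≃M₀ F≃M₁ ⟩
    nextF (hM M₀) (hM M₁)     ≈⟨ nextF-hM M₀ M₁ ⟩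
    hM M₀ · hM (M₀ ⊕ SM -1ℤ M₀) ⊞ scale (+ 2) (hM M₀ · hM (M₀ ⊕ M₁)) ⊞ hM M₁ · hM (M₀ ⊕ M₀) ∎)
  where
  open ≃-Reasoning
  open Shape (shape n)
  E≃M₀ : E n ≃ hM M₀
  E≃M₀ = ≃-sym (≈⇒≃ M₀≈E)
  F≃M₁ : F n ≃ hM M₁
  F≃M₁ = ≃-trans H≃ (≃-trans (≃-reflexive (cong (λ c → S c Q) (F-exponent≡2^[1+n]-1 n))) (≃-sym M₁≃))
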